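{- Let $n\ge1$, $d\ge0$. Every sorted compact configuration on $S_{n,d}$ is toppling-and-permuting equivalent to exactly $n+1$ sorted quasi-stable non-negative configurations.
   Context: The complete split graph $S_{n,d}$ has a sink $s$, clique component $K=\{v_1,\ldots,v_n\}$ and independent component $I=\{w_1,\ldots,w_d\}$; any two distinct vertices among $s,v_1,\ldots,v_n$ are adjacent, each $w_j$ is adjacent to each of $s,v_1,\ldots,v_n$, no two $w_j$'s are adjacent; $\deg(v_i)=\deg(s)=n+d$, $\deg(w_j)=n+1$. A configuration is any $u=(u^{[K]};u^{[I]})\in\mathbb{Z}^n\times\mathbb{Z}^d$, the sink carrying $u_s=-(\text{sum of all entries})$. $\Delta^{(v)}$ is the toppling vector of vertex $v$ (including $s$): adding it removes $\deg(v)$ grains from $v$ and adds one grain to each neighbour. Permutations $\sigma^{[C]}$ of a component $C$ act by $(\sigma^{[C]}.u^{[C]})_c=u^{[C]}_{\sigma^{[C]}(c)}$. Configurations $u,u'$ are toppling-and-permuting equivalent if $u'=(\sigma^{[K]},\sigma^{[I]}).u+\sum_v a_v\Delta^{(v)}$ for some permutations $\sigma^{[K]},\sigma^{[I]}$ of $K$, $I$ and integers $(a_v)$ indexed by all vertices including $s$. Sorted: $u^{[K]}$ and $u^{[I]}$ weakly decreasing. Compact: $\max u^{[K]}-\min u^{[K]}\le n+d+1$ and $\max u^{[I]}-\min u^{[I]}\le n+1$. Quasi-stable: $\max u^{[K]}\le n+d$ and $\max u^{[I]}\le n$. Non-negative: all non-sink entries $\ge0$. -}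

module Defs where

open import Data.Nat as ℕ using (ℕ; suc)
open import Data.Integer as ℤ using (ℤ; +_; -_; _+_; _*_; _-_; _≤_)
open import Data.Fin as Fin using (Fin)
open import Data.Vec using (Vec; lookup; tabulate)
open import Data.List using (List; _∷_; []; map; _++_; allFin; foldr)
open import Data.Fin.Permutation using (Permutation′; _⟨$⟩ʳ_)
open import Data.Product using (Σ; _×_; _,_; ∃)
open import Relation.Binary.PropositionalEquality using (_≡_)
open import Relation.Nullary using (yes; no)

data Vertex (n d : ℕ) : Set where
  sink  : Vertex n d
  vK    : Fin n → Vertex n d
  wI    : Fin d → Vertex n d

allVertices : (n d : ℕ) → List (Vertex n d)
allVertices n d = sink ∷ (map vK (allFin n) ++ map wI (allFin d))

sumℤ : List ℤ → ℤ
sumℤ = foldr _+_ (+ 0)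

adj : {n d : ℕ} → Vertex n d → Vertex n d → ℤ
adj sink   sink   = + 0
adj sink   (vK _) = + 1
adj sink   (wI _) = + 1
adj (vK _) sink   = + 1
adj (vK i) (vK j) with i Fin.≟ j
... | yes _ = + 0
... | no  _ = + 1
adj (vK _) (wI _) = + 1
adj (wI _) sink   = + 1
adj (wI _) (vK _) = + 1
adj (wI _) (wI _) = + 0

deg : {n d : ℕ} → Vertex n d → ℕ
deg {n} {d} sink   = n ℕ.+ d
deg {n} {d} (vK _) = n ℕ.+ d
deg {n} {d} (wI _) = n ℕ.+ 1

δ : {n d : ℕ} → Vertex n d → Vertex n d → ℤ
δ sink   sink   = + 1
δ (vK i) (vK j) with i Fin.≟ j
... | yes _ = + 1
... | no  _ = + 0
δ (wI i) (wI j) with i Fin.≟ j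
... | yes _ = + 1
... | no  _ = + 0
δ _ _ = + 0

Δ : {n d : ℕ} → Vertex n d → Vertex n d → ℤ
Δ v x = adj v x - δ v x * (+ deg v)

Config : ℕ → ℕ → Set
Config n d = Vec ℤ n × Vec ℤ d

sumVec : {m : ℕ} → Vec ℤ m → ℤ
sumVec {m} v = sumℤ (map (lookup v) (allFin m))

val : {n d : ℕ} → Config n d → Vertex n d → ℤ
val (uK , uI) sink   = - (sumVec uK + sumVec uI)
val (uK , uI) (vK i) = lookup uK i
val (uK , uI) (wI j) = lookup uI j

act : {m : ℕ} → Permutation′ m → Vec ℤ m → Vec ℤ m
act σ u = tabulate (λ c → lookup u (σ ⟨$⟩ʳ c))

TPEquiv : {n d : ℕ} → Config n d → Config n d → Set
TPEquiv {n} {d} (uK , uI) u' =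
  Σ (Permutation′ n) λ σK → Σ (Permutation′ d) λ σI → Σ (Vertex n d → ℤ) λ a →
    (x : Vertex n d) →
      val u' x ≡ val (act σK uK , act σI uI) x
                 + sumℤ (map (λ v → a v * Δ v x) (allVertices n d))

Decreasing : {m : ℕ} → Vec ℤ m → Set
Decreasing {m} u = (i j : Fin m) → i Fin.≤ j → lookup u j ≤ lookup u i

Sorted : {n d : ℕ} → Config n d → Set
Sorted (uK , uI) = Decreasing uK × Decreasing uI

-- max u - min u ≤ b, written out as: all pairwise differences ≤ b
Spread≤ : {m : ℕ} → Vec ℤ m → ℕ → Set
Spread≤ {m} u b = (i j : Fin m) → lookup u i - lookup u j ≤ + b

Compact : {n d : ℕ} → Config n d → Set
Compact {n} {d} (uK , uI) = Spread≤ uK (n ℕ.+ d ℕ.+ 1) × Spread≤ uI (n ℕ.+ 1)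

AllLe : {m : ℕ} → Vec ℤ m → ℕ → Set
AllLe {m} u b = (i : Fin m) → lookup u i ≤ + b

QuasiStable : {n d : ℕ} → Config n d → Set
QuasiStable {n} {d} (uK , uI) = AllLe uK (n ℕ.+ d) × AllLe uI n

NonNegative : {n d : ℕ} → Config n d → Set
NonNegative {n} {d} (uK , uI) =
  ((i : Fin n) → + 0 ≤ lookup uK i) × ((j : Fin d) → + 0 ≤ lookup uI j)

-- Let c be non-negative, quasi-stable and equivalent to u through the firing vector t, and let T
-- be the number of firings of the sink and the clique together. Each w_k gains T grains and loses
-- n + 1 per firing, so quasi-stability forces it to fire ⌊(u_{w_k} + T)/(n+1)⌋ times and to end
-- with the remainder; the total number of firings is then known, and the same argument modulo
-- n + d + 1 fixes every clique entry. Hence the sorted c is determined by T, in fact by T mod (n+1),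
-- and each residue yields a valid c. Distinct residues 0 ≤ a < b ≤ n give distinct c: their totals
-- satisfy total(a) < total(b) < total(a) + n + d + 1, while the sink entry of c fixes the total
-- modulo n + d + 1.
module Submission where

open import Defs

module Lemmas where
  open import Data.Nat as ℕ using (ℕ; zero; suc; NonZero; z≤n; s≤s)
  import Data.Nat.Properties as ℕP
  open import Data.Vec.Functional using (removeAt)
  open import Data.Integer as ℤ
    using (ℤ; +_; -_; _+_; _*_; _-_; _≤_; _<_; +≤+; +<+; 0ℤ; 1ℤ; _/ℕ_; _%ℕ_)
  open import Data.Integer.Properties as ℤP using (+-*-semiring)
  open import Data.Integer.DivMod using (a≡a%ℕn+[a/ℕn]*n; n%ℕd<d; [n/ℕd]*d≤n; n<s[n/ℕd]*d)
  open import Data.Integer.Solver using (module +-*-Solver)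
  open import Data.Fin as Fin using (Fin; toℕ; fromℕ<; inject≤)
  import Data.Fin.Properties as FinP
  open import Data.Fin.Permutation as Perm using (Permutation′; _⟨$⟩ʳ_; _⟨$⟩ˡ_; _∘ₚ_; transpose; lift₀)
  open import Data.Vec as Vec using (Vec; lookup)
  open import Data.Vec.Properties using (lookup∘tabulate; tabulate∘lookup; tabulate-cong)
  open import Function.Definitions using (Injective)
  open import Function.Bundles using (Injection)
  open import Function.Properties.Inverse using (↔⇒↣)
  open import Data.List using (List; []; _∷_; _++_; map; tabulate; allFin)
  import Data.List.Properties as LP
  open import Algebra.Properties.Semiring.Sum +-*-semiring
    using (sum; sum-cong-≗; sum-remove; sum-replicate-zero; sum-permute; ∑-distrib-+)
  open import Data.Product using (_×_; _,_; proj₁; proj₂; ∃)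
  open import Data.Empty using (⊥; ⊥-elim)
  open import Relation.Binary.PropositionalEquality
  open import Relation.Nullary using (yes; no)
  open import Relation.Binary.Definitions using (tri<; tri≈; tri>)

  open +-*-Solver

  -- Finite sums of integers

  sumℤ-++ : (xs ys : List ℤ) → sumℤ (xs ++ ys) ≡ sumℤ xs + sumℤ ys
  sumℤ-++ []       ys = sym (ℤP.+-identityˡ _)
  sumℤ-++ (x ∷ xs) ys = trans (cong (_+_ x) (sumℤ-++ xs ys)) (sym (ℤP.+-assoc x _ _))

  sumℤ-map-tabulate : ∀ {A : Set} {m} (h : A → ℤ) (f : Fin m → A) →
                      sumℤ (map h (tabulate f)) ≡ sum (λ i → h (f i))
  sumℤ-map-tabulate {m = zero}  h f = refl
  sumℤ-map-tabulate {m = suc m} h f = cong (_+_ (h (f Fin.zero))) (sumℤ-map-tabulate h (λ i → f (Fin.suc i)))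

  sum-const : ∀ {m} (c : ℤ) → sum {m} (λ _ → c) ≡ + m * c
  sum-const {zero}  c = refl
  sum-const {suc m} c = trans (cong (_+_ c) (sum-const {m} c)) (sym (ℤP.suc-* (+ m) c))

  sum-affine : ∀ {m} (c k : ℤ) (f : Fin m → ℤ) → sum (λ i → c - k * f i) ≡ + m * c - k * sum f
  sum-affine {zero}  c k f = sym (cong (λ x → 0ℤ - x) (ℤP.*-zeroʳ k))
  sum-affine {suc m} c k f =
    trans (cong (_+_ (c - k * f Fin.zero)) (sum-affine c k (λ i → f (Fin.suc i))))
          (solve 5 (λ c k x m s → (c :- k :* x) :+ (m :* c :- k :* s) := (con 1ℤ :+ m) :* c :- k :* (x :+ s))
                 refl c k (f Fin.zero) (+ m) (sum (λ i → f (Fin.suc i))))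

  sum-mono-≤ : ∀ {m} {f g : Fin m → ℤ} → (∀ i → f i ≤ g i) → sum f ≤ sum g
  sum-mono-≤ {zero}  f≤g = ℤP.≤-refl
  sum-mono-≤ {suc m} f≤g = ℤP.+-mono-≤ (f≤g Fin.zero) (sum-mono-≤ (λ i → f≤g (Fin.suc i)))

  sum-cong-except : ∀ {m} {f g : Fin m → ℤ} (i : Fin m) → (∀ j → j ≢ i → f j ≡ g j) →
                    sum f - f i ≡ sum g - g i
  sum-cong-except {suc m} {f} {g} i f≗g = begin
    sum f - f i                      ≡⟨ cong (_- f i) (sum-remove f) ⟩
    (f i + sum (removeAt f i)) - f i ≡⟨ +-minus-cancel (f i) _ ⟩
    sum (removeAt f i)               ≡⟨ sum-cong-≗ (λ k → f≗g _ (FinP.punchInᵢ≢i i k)) ⟩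
    sum (removeAt g i)               ≡⟨ +-minus-cancel (g i) _ ⟨
    (g i + sum (removeAt g i)) - g i ≡⟨ cong (_- g i) (sum-remove g) ⟨
    sum g - g i                      ∎
    where
    open ≡-Reasoning
    +-minus-cancel : ∀ x y → (x + y) - x ≡ y
    +-minus-cancel = solve 2 (λ x y → (x :+ y) :- x := y) refl

  -- Division with remainder by a positive natural number

  +-cancelˡ-< : ∀ i {x y} → i + x < i + y → x < y
  +-cancelˡ-< i {x} {y} lt = subst₂ _<_ (-i+[i+x]≡x x) (-i+[i+x]≡x y) (ℤP.+-monoʳ-< (- i) lt)
    where
    -i+[i+x]≡x : ∀ x → - i + (i + x) ≡ x
    -i+[i+x]≡x x = solve 2 (λ i x → :- i :+ (i :+ x) := x) refl i x

  module _ (m : ℕ) .{{_ : NonZero m}} where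

    private
      i*n<[1+j]*n⇒i≤j : ∀ {p q} → p * + m < ℤ.suc q * + m → p ≤ q
      i*n<[1+j]*n⇒i≤j {p} {q} lt =
        subst (p ≤_) (ℤP.pred-suc q) (ℤP.i<j⇒i≤pred[j] (ℤP.*-cancelʳ-<-nonNeg {p} {ℤ.suc q} (+ m) lt))

    +[a%ℕn]≡a-n*[a/ℕn] : ∀ a → + (a %ℕ m) ≡ a - + m * (a /ℕ m)
    +[a%ℕn]≡a-n*[a/ℕn] a = begin
      + (a %ℕ m)
        ≡⟨ solve 3 (λ r q m → r := (r :+ q :* m) :- m :* q) refl (+ (a %ℕ m)) (a /ℕ m) (+ m) ⟩
      (+ (a %ℕ m) + (a /ℕ m) * + m) - + m * (a /ℕ m)
        ≡⟨ cong (_- + m * (a /ℕ m)) (a≡a%ℕn+[a/ℕn]*n a m) ⟨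
      a - + m * (a /ℕ m) ∎
      where open ≡-Reasoning

    /ℕ-%ℕ-unique : ∀ a {q r} → 0ℤ ≤ r → r < + m → r ≡ a - + m * q → a /ℕ m ≡ q × + (a %ℕ m) ≡ r
    /ℕ-%ℕ-unique a {q} {+ r} _ r<m r≡ =
      a/m≡q , trans (+[a%ℕn]≡a-n*[a/ℕn] a) (trans (cong (λ p → a - + m * p) a/m≡q) (sym r≡))
      where
      open ℤP.≤-Reasoning
      a≡ : a ≡ + r + q * + m
      a≡ = trans (solve 3 (λ a q m → a := (a :- m :* q) :+ q :* m) refl a q (+ m)) (cong (_+ q * + m) (sym r≡))
      a/m≡q : a /ℕ m ≡ q
      a/m≡q = ℤP.≤-antisym
        (i*n<[1+j]*n⇒i≤j (begin-strict
          a /ℕ m * + m    ≤⟨ [n/ℕd]*d≤n a m ⟩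
          a               ≡⟨ a≡ ⟩
          + r + q * + m   <⟨ ℤP.+-monoˡ-< (q * + m) r<m ⟩
          + m + q * + m   ≡⟨ ℤP.suc-* q (+ m) ⟨
          ℤ.suc q * + m   ∎))
        (i*n<[1+j]*n⇒i≤j (begin-strict
          q * + m         ≤⟨ ℤP.i≤j+i (q * + m) (+ r) ⟩
          + r + q * + m   ≡⟨ a≡ ⟨
          a               <⟨ n<s[n/ℕd]*d a m ⟩
          ℤ.suc (a /ℕ m) * + m ∎))

    private
      divMod-+n*q : ∀ a q → (a + + m * q) /ℕ m ≡ a /ℕ m + q × + ((a + + m * q) %ℕ m) ≡ + (a %ℕ m)
      divMod-+n*q a q = /ℕ-%ℕ-unique (a + + m * q) (+≤+ z≤n) (+<+ (n%ℕd<d a m)) (begin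
        + (a %ℕ m)
          ≡⟨ +[a%ℕn]≡a-n*[a/ℕn] a ⟩
        a - + m * (a /ℕ m)
          ≡⟨ solve 4 (λ a m p q → a :- m :* p := (a :+ m :* q) :- m :* (p :+ q)) refl a (+ m) (a /ℕ m) q ⟩
        (a + + m * q) - + m * (a /ℕ m + q) ∎)
        where open ≡-Reasoning

    [a+n*q]/ℕn≡a/ℕn+q : ∀ a q → (a + + m * q) /ℕ m ≡ a /ℕ m + q
    [a+n*q]/ℕn≡a/ℕn+q a q = proj₁ (divMod-+n*q a q)

    [a+n*q]%ℕn≡a%ℕn : ∀ a q → (a + + m * q) %ℕ m ≡ a %ℕ m
    [a+n*q]%ℕn≡a%ℕn a q = ℤP.+-injective (proj₂ (divMod-+n*q a q))

    /ℕ-monoˡ-≤ : ∀ {a b} → a ≤ b → a /ℕ m ≤ b /ℕ m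
    /ℕ-monoˡ-≤ {a} {b} a≤b =
      i*n<[1+j]*n⇒i≤j (ℤP.≤-<-trans ([n/ℕd]*d≤n a m) (ℤP.≤-<-trans a≤b (n<s[n/ℕd]*d b m)))

    ¬0<n*q<n : ∀ q → 0ℤ < + m * q → + m * q < + m → ⊥
    ¬0<n*q<n q 0<mq mq<m = ℤP.<-irrefl refl (ℤP.≤-<-trans (ℤP.i<j⇒suc[i]≤j 0<q) q<1)
      where
      0<q : 0ℤ < q
      0<q = ℤP.*-cancelˡ-<-nonNeg (+ m) (subst (_< + m * q) (sym (ℤP.*-zeroʳ (+ m))) 0<mq)
      q<1 : q < 1ℤ
      q<1 = ℤP.*-cancelˡ-<-nonNeg (+ m) (subst (+ m * q <_) (sym (ℤP.*-identityʳ (+ m))) mq<m)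

    /ℕ-≤-/ℕ+1 : ∀ {a b} → b < a + + m → b /ℕ m ≤ a /ℕ m + 1ℤ
    /ℕ-≤-/ℕ+1 {a} {b} b<a+m = i*n<[1+j]*n⇒i≤j (begin-strict
      b /ℕ m * + m                 ≤⟨ [n/ℕd]*d≤n b m ⟩
      b                            <⟨ b<a+m ⟩
      a + + m                      <⟨ ℤP.+-monoˡ-< (+ m) (n<s[n/ℕd]*d a m) ⟩
      ℤ.suc (a /ℕ m) * + m + + m
        ≡⟨ solve 2 (λ p m → (con 1ℤ :+ p) :* m :+ m := (con 1ℤ :+ (p :+ con 1ℤ)) :* m) refl (a /ℕ m) (+ m) ⟩
      ℤ.suc (a /ℕ m + 1ℤ) * + m    ∎)
      where open ℤP.≤-Reasoning

  -- Sorting by a permutation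

  permute : ∀ {m} → Permutation′ m → (Fin m → ℤ) → Vec ℤ m
  permute π f = Vec.tabulate (λ i → f (π ⟨$⟩ʳ i))

  lookup-permute : ∀ {m} (π : Permutation′ m) (f : Fin m → ℤ) i → lookup (permute π f) i ≡ f (π ⟨$⟩ʳ i)
  lookup-permute π f = lookup∘tabulate (λ i → f (π ⟨$⟩ʳ i))

  lookup-extensional : ∀ {m} {u w : Vec ℤ m} → (∀ i → lookup u i ≡ lookup w i) → u ≡ w
  lookup-extensional {u = u} {w} u≗w = trans (sym (tabulate∘lookup u)) (trans (tabulate-cong u≗w) (tabulate∘lookup w))

  argmax : ∀ {m} (f : Fin (suc m) → ℤ) → ∃ λ k → ∀ j → f j ≤ f k
  argmax {zero}  f = Fin.zero , λ { Fin.zero → ℤP.≤-refl }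
  argmax {suc m} f with argmax (λ i → f (Fin.suc i))
  ... | k , f≤fk with f Fin.zero ℤP.≤? f (Fin.suc k)
  ...   | yes f0≤fk = Fin.suc k , λ { Fin.zero → f0≤fk ; (Fin.suc j) → f≤fk j }
  ...   | no  f0≰fk = Fin.zero , λ where
            Fin.zero    → ℤP.≤-refl
            (Fin.suc j) → ℤP.≤-trans (f≤fk j) (ℤP.<⇒≤ (ℤP.≰⇒> f0≰fk))

  private
    sorting : ∀ {m} (f : Fin m → ℤ) →
              ∃ λ (π : Permutation′ m) → ∀ i j → i Fin.≤ j → f (π ⟨$⟩ʳ j) ≤ f (π ⟨$⟩ʳ i)
    sorting {zero}  f = Perm.id , λ ()
    sorting {suc m} f with argmax f
    ... | k , f≤fk with sorting (λ i → f (transpose Fin.zero k ⟨$⟩ʳ Fin.suc i))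
    ...   | ρ , ρ↓ = lift₀ ρ ∘ₚ transpose Fin.zero k , λ where
            Fin.zero    j           _         → f≤fk _
            (Fin.suc i) (Fin.suc j) (s≤s i≤j) → ρ↓ i j i≤j

  sortingPermutation : ∀ {m} (f : Fin m → ℤ) → ∃ λ π → Decreasing (permute π f)
  sortingPermutation f with sorting f
  ... | π , π↓ = π , λ i j i≤j → subst₂ _≤_ (sym (lookup-permute π f j)) (sym (lookup-permute π f i)) (π↓ i j i≤j)

  decreasing-rearrangement-≤ : ∀ {m} {u w : Vec ℤ m} → Decreasing u → Decreasing w →
                               (ρ : Fin m → Fin m) → Injective _≡_ _≡_ ρ →
                               (∀ i → lookup w i ≡ lookup u (ρ i)) → ∀ i → lookup w i ≤ lookup u i
  decreasing-rearrangement-≤ {m} {u} {w} u↓ w↓ ρ ρ-injective w≡uρ i with lookup w i ℤP.≤? lookup u i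
  ... | yes wi≤ui = wi≤ui
  -- If w i > u i, then ρ maps the i + 1 positions j ≤ i injectively to the i positions below i.
  ... | no  wi≰ui = ⊥-elim (FinP.<⇒notInjective (ℕP.n<1+n (toℕ i)) φ-injective)
    where
    i<m : suc (toℕ i) ℕ.≤ m
    i<m = FinP.toℕ<n i
    ι : Fin (suc (toℕ i)) → Fin m
    ι j = inject≤ j i<m
    ι≤i : ∀ j → ι j Fin.≤ i
    ι≤i j = subst (ℕ._≤ toℕ i) (sym (FinP.toℕ-inject≤ j i<m)) (ℕ.s≤s⁻¹ (FinP.toℕ<n j))
    ρι<i : ∀ j → toℕ (ρ (ι j)) ℕ.< toℕ i
    ρι<i j = ℕP.≰⇒> λ i≤ριj → wi≰ui (begin
      lookup w i           ≤⟨ w↓ (ι j) i (ι≤i j) ⟩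
      lookup w (ι j)       ≡⟨ w≡uρ (ι j) ⟩
      lookup u (ρ (ι j))   ≤⟨ u↓ i (ρ (ι j)) i≤ριj ⟩
      lookup u i           ∎)
      where open ℤP.≤-Reasoning
    φ : Fin (suc (toℕ i)) → Fin (toℕ i)
    φ j = fromℕ< (ρι<i j)
    φ-injective : Injective _≡_ _≡_ φ
    φ-injective {a} {b} φa≡φb = FinP.inject≤-injective i<m i<m a b (ρ-injective (FinP.toℕ-injective (begin
      toℕ (ρ (ι a))  ≡⟨ FinP.toℕ-fromℕ< (ρι<i a) ⟨
      toℕ (φ a)      ≡⟨ cong toℕ φa≡φb ⟩
      toℕ (φ b)      ≡⟨ FinP.toℕ-fromℕ< (ρι<i b) ⟩
      toℕ (ρ (ι b))  ∎)))
      where open ≡-Reasoning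

  decreasing-permute-unique : ∀ {m} (f : Fin m → ℤ) (σ π : Permutation′ m) →
                              Decreasing (permute σ f) → Decreasing (permute π f) → permute σ f ≡ permute π f
  decreasing-permute-unique f σ π σ↓ π↓ =
    lookup-extensional λ i → ℤP.≤-antisym (below σ π σ↓ π↓ i) (below π σ π↓ σ↓ i)
    where
    below : ∀ σ π → Decreasing (permute σ f) → Decreasing (permute π f) →
            ∀ i → lookup (permute σ f) i ≤ lookup (permute π f) i
    below σ π σ↓ π↓ = decreasing-rearrangement-≤ {u = permute π f} {permute σ f} π↓ σ↓
                        (ρ ⟨$⟩ʳ_) (Injection.injective (↔⇒↣ ρ)) λ i → begin
      lookup (permute σ f) i                     ≡⟨ lookup-permute σ f i ⟩
      f (σ ⟨$⟩ʳ i)                               ≡⟨ cong f (Perm.inverseʳ π) ⟨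
      f (π ⟨$⟩ʳ (π ⟨$⟩ˡ (σ ⟨$⟩ʳ i)))             ≡⟨ lookup-permute π f _ ⟨
      lookup (permute π f) (π ⟨$⟩ˡ (σ ⟨$⟩ʳ i))   ∎
      where
      open ≡-Reasoning
      ρ = σ ∘ₚ Perm.flip π

  decreasing-rearrangement≡sorted : ∀ {m} {v : Vec ℤ m} (f : Fin m → ℤ) (τ : Permutation′ m) → Decreasing v →
                                    (∀ i → lookup v i ≡ f (τ ⟨$⟩ʳ i)) → v ≡ permute (proj₁ (sortingPermutation f)) f
  decreasing-rearrangement≡sorted {v = v} f τ v↓ v≡fτ =
    trans v≡ (decreasing-permute-unique f τ π (subst Decreasing v≡ v↓) π↓)
    where
    π = proj₁ (sortingPermutation f)
    π↓ = proj₂ (sortingPermutation f)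
    v≡ : v ≡ permute τ f
    v≡ = lookup-extensional (λ i → trans (v≡fτ i) (sym (lookup-permute τ f i)))

  -- Toppling on S_{n,d}

  toppleBy : ∀ {n d} → (Vertex n d → ℤ) → Vertex n d → ℤ
  toppleBy {n} {d} a x = sumℤ (map (λ v → a v * Δ v x) (allVertices n d))

  totalTopplings : ∀ {n d} → (Vertex n d → ℤ) → ℤ
  totalTopplings a = a sink + (sum (λ i → a (vK i)) + sum (λ k → a (wI k)))

  sumℤ-allVertices : ∀ {n d} (h : Vertex n d → ℤ) →
                     sumℤ (map h (allVertices n d)) ≡ h sink + (sum (λ i → h (vK i)) + sum (λ k → h (wI k)))
  sumℤ-allVertices {n} {d} h = cong (_+_ (h sink)) (begin
    sumℤ (map h (map vK (allFin n) ++ map wI (allFin d)))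
      ≡⟨ cong sumℤ (LP.map-++ h (map vK (allFin n)) (map wI (allFin d))) ⟩
    sumℤ (map h (map vK (allFin n)) ++ map h (map wI (allFin d)))
      ≡⟨ sumℤ-++ (map h (map vK (allFin n))) (map h (map wI (allFin d))) ⟩
    sumℤ (map h (map vK (allFin n))) + sumℤ (map h (map wI (allFin d)))
      ≡⟨ cong₂ _+_ (cong sumℤ (LP.map-∘ (allFin n))) (cong sumℤ (LP.map-∘ (allFin d))) ⟨
    sumℤ (map (λ i → h (vK i)) (allFin n)) + sumℤ (map (λ k → h (wI k)) (allFin d))
      ≡⟨ cong₂ _+_ (sumℤ-map-tabulate (λ i → h (vK i)) (λ i → i)) (sumℤ-map-tabulate (λ k → h (wI k)) (λ k → k)) ⟩
    sum (λ i → h (vK i)) + sum (λ k → h (wI k)) ∎)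
    where open ≡-Reasoning

  module _ {n d : ℕ} where

    Δ-vK-vK-≢ : ∀ {i j : Fin n} → j ≢ i → Δ {n} {d} (vK j) (vK i) ≡ 1ℤ
    Δ-vK-vK-≢ {i} {j} j≢i with j Fin.≟ i
    ... | yes j≡i = ⊥-elim (j≢i j≡i)
    ... | no  _   = refl

    Δ-vK-vK : ∀ (i : Fin n) → Δ {n} {d} (vK i) (vK i) ≡ - + (n ℕ.+ d)
    Δ-vK-vK i with i Fin.≟ i
    ... | yes _   = trans (ℤP.+-identityˡ _) (cong -_ (ℤP.*-identityˡ (+ (n ℕ.+ d))))
    ... | no  i≢i = ⊥-elim (i≢i refl)

    Δ-wI-wI-≢ : ∀ {k l : Fin d} → l ≢ k → Δ {n} {d} (wI l) (wI k) ≡ 0ℤ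
    Δ-wI-wI-≢ {k} {l} l≢k with l Fin.≟ k
    ... | yes l≡k = ⊥-elim (l≢k l≡k)
    ... | no  _   = refl

    Δ-wI-wI : ∀ (k : Fin d) → Δ {n} {d} (wI k) (wI k) ≡ - + (n ℕ.+ 1)
    Δ-wI-wI k with k Fin.≟ k
    ... | yes _   = trans (ℤP.+-identityˡ _) (cong -_ (ℤP.*-identityˡ (+ (n ℕ.+ 1))))
    ... | no  k≢k = ⊥-elim (k≢k refl)

    private
      sum-*1 : ∀ {m} (f : Fin m → ℤ) → sum (λ j → f j * 1ℤ) ≡ sum f
      sum-*1 f = sum-cong-≗ (λ j → ℤP.*-identityʳ (f j))

      x≡[x-y]+y : ∀ x y → x ≡ (x - y) + y
      x≡[x-y]+y = solve 2 (λ x y → x := (x :- y) :+ y) refl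

    toppleBy-vK : ∀ (a : Vertex n d → ℤ) i → toppleBy a (vK i) ≡ totalTopplings a - + suc (n ℕ.+ d) * a (vK i)
    toppleBy-vK a i = begin
      toppleBy a (vK i)
        ≡⟨ sumℤ-allVertices (λ v → a v * Δ v (vK i)) ⟩
      a sink * 1ℤ + (sum (λ j → a (vK j) * Δ (vK j) (vK i)) + sum (λ k → a (wI k) * 1ℤ))
        ≡⟨ cong₂ (λ x y → a sink * 1ℤ + (x + y)) clique-column (sum-*1 (λ k → a (wI k))) ⟩
      a sink * 1ℤ + ((K - + suc (n ℕ.+ d) * a (vK i)) + W)
        ≡⟨ solve 5 (λ s K W x D → s :* con 1ℤ :+ ((K :- (con 1ℤ :+ D) :* x) :+ W) := (s :+ (K :+ W)) :- (con 1ℤ :+ D) :* x)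
                 refl (a sink) K W (a (vK i)) (+ (n ℕ.+ d)) ⟩
      totalTopplings a - + suc (n ℕ.+ d) * a (vK i) ∎
      where
      open ≡-Reasoning
      K = sum (λ j → a (vK j))
      W = sum (λ k → a (wI k))
      clique-column : sum (λ j → a (vK j) * Δ (vK j) (vK i)) ≡ K - + suc (n ℕ.+ d) * a (vK i)
      clique-column = begin
        sum (λ j → a (vK j) * Δ (vK j) (vK i))
          ≡⟨ x≡[x-y]+y _ _ ⟩
        (sum (λ j → a (vK j) * Δ (vK j) (vK i)) - a (vK i) * Δ (vK i) (vK i)) + a (vK i) * Δ (vK i) (vK i)
          ≡⟨ cong₂ _+_ (sum-cong-except i (λ j j≢i → trans (cong (a (vK j) *_) (Δ-vK-vK-≢ j≢i)) (ℤP.*-identityʳ _)))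
                       (cong (a (vK i) *_) (Δ-vK-vK i)) ⟩
        (K - a (vK i)) + a (vK i) * - + (n ℕ.+ d)
          ≡⟨ solve 3 (λ K x D → (K :- x) :+ x :* (:- D) := K :- (con 1ℤ :+ D) :* x) refl K (a (vK i)) (+ (n ℕ.+ d)) ⟩
        K - + suc (n ℕ.+ d) * a (vK i) ∎

    toppleBy-wI : ∀ (a : Vertex n d → ℤ) k → toppleBy a (wI k) ≡ (a sink + sum (λ i → a (vK i))) - + suc n * a (wI k)
    toppleBy-wI a k = begin
      toppleBy a (wI k)
        ≡⟨ sumℤ-allVertices (λ v → a v * Δ v (wI k)) ⟩
      a sink * 1ℤ + (sum (λ j → a (vK j) * 1ℤ) + sum (λ l → a (wI l) * Δ (wI l) (wI k)))
        ≡⟨ cong₂ (λ x y → a sink * 1ℤ + (x + y)) (sum-*1 (λ j → a (vK j))) independent-column ⟩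
      a sink * 1ℤ + (K - + suc n * a (wI k))
        ≡⟨ solve 4 (λ s K x M → s :* con 1ℤ :+ (K :- M :* x) := (s :+ K) :- M :* x) refl (a sink) K (a (wI k)) (+ suc n) ⟩
      (a sink + K) - + suc n * a (wI k) ∎
      where
      open ≡-Reasoning
      K = sum (λ j → a (vK j))
      independent-column : sum (λ l → a (wI l) * Δ (wI l) (wI k)) ≡ - (+ suc n * a (wI k))
      independent-column = begin
        sum (λ l → a (wI l) * Δ (wI l) (wI k))
          ≡⟨ x≡[x-y]+y _ _ ⟩
        (sum (λ l → a (wI l) * Δ (wI l) (wI k)) - a (wI k) * Δ (wI k) (wI k)) + a (wI k) * Δ (wI k) (wI k)
          ≡⟨ cong₂ _+_ (sum-cong-except k λ l l≢k →
                          trans (cong (a (wI l) *_) (Δ-wI-wI-≢ l≢k)) (ℤP.*-zeroʳ (a (wI l))))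
                       (cong (a (wI k) *_) (trans (Δ-wI-wI k) (cong (λ m → - + m) (ℕP.+-comm n 1)))) ⟩
        (sum {d} (λ _ → 0ℤ) - 0ℤ) + a (wI k) * - + suc n
          ≡⟨ cong (λ z → (z - 0ℤ) + a (wI k) * - + suc n) (sum-replicate-zero d) ⟩
        0ℤ - 0ℤ + a (wI k) * - + suc n
          ≡⟨ solve 2 (λ x M → con 0ℤ :- con 0ℤ :+ x :* (:- M) := :- (M :* x)) refl (a (wI k)) (+ suc n) ⟩
        - (+ suc n * a (wI k)) ∎

    toppleBy-sink : ∀ (a : Vertex n d → ℤ) → toppleBy a sink ≡ totalTopplings a - + suc (n ℕ.+ d) * a sink
    toppleBy-sink a = begin
      toppleBy a sink
        ≡⟨ sumℤ-allVertices (λ v → a v * Δ v sink) ⟩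
      a sink * (0ℤ - 1ℤ * + (n ℕ.+ d)) + (sum (λ j → a (vK j) * 1ℤ) + sum (λ k → a (wI k) * 1ℤ))
        ≡⟨ cong₂ (λ x y → a sink * (0ℤ - 1ℤ * + (n ℕ.+ d)) + (x + y))
                 (sum-*1 (λ j → a (vK j))) (sum-*1 (λ k → a (wI k))) ⟩
      a sink * (0ℤ - 1ℤ * + (n ℕ.+ d)) + (sum (λ j → a (vK j)) + sum (λ k → a (wI k)))
        ≡⟨ solve 3 (λ s T D → s :* (con 0ℤ :- con 1ℤ :* D) :+ T := (s :+ T) :- (con 1ℤ :+ D) :* s)
                 refl (a sink) (sum (λ j → a (vK j)) + sum (λ k → a (wI k))) (+ (n ℕ.+ d)) ⟩
      totalTopplings a - + suc (n ℕ.+ d) * a sink ∎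
      where open ≡-Reasoning

    toppleBy-conserves : ∀ (a : Vertex n d → ℤ) →
                         toppleBy a sink + (sum (λ i → toppleBy a (vK i)) + sum (λ k → toppleBy a (wI k))) ≡ 0ℤ
    toppleBy-conserves a = begin
      toppleBy a sink + (sum (λ i → toppleBy a (vK i)) + sum (λ k → toppleBy a (wI k)))
        ≡⟨ cong₂ _+_ (toppleBy-sink a)
                 (cong₂ _+_ (sum-cong-≗ (toppleBy-vK a)) (sum-cong-≗ (toppleBy-wI a))) ⟩
      (T - N * s) + (sum (λ i → T - N * a (vK i)) + sum (λ k → (s + K) - M * a (wI k)))
        ≡⟨ cong₂ (λ x y → (T - N * s) + (x + y))
                 (sum-affine T N (λ i → a (vK i))) (sum-affine (s + K) M (λ k → a (wI k))) ⟩
      (T - N * s) + ((+ n * T - N * K) + (+ d * (s + K) - M * W))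
        ≡⟨ cong (λ D → (T - (1ℤ + D) * s) + ((+ n * T - (1ℤ + D) * K) + (+ d * (s + K) - M * W))) (ℤP.pos-+ n d) ⟩
      (T - (1ℤ + (+ n + + d)) * s) + ((+ n * T - (1ℤ + (+ n + + d)) * K) + (+ d * (s + K) - (1ℤ + + n) * W))
        ≡⟨ solve 5 (λ s K W n d → ((s :+ (K :+ W)) :- (con 1ℤ :+ (n :+ d)) :* s)
                                 :+ ((n :* (s :+ (K :+ W)) :- (con 1ℤ :+ (n :+ d)) :* K)
                                 :+ (d :* (s :+ K) :- (con 1ℤ :+ n) :* W)) := con 0ℤ)
                 refl s K W (+ n) (+ d) ⟩
      0ℤ ∎
      where
      open ≡-Reasoning
      s = a sink
      K = sum (λ i → a (vK i))
      W = sum (λ k → a (wI k))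
      T = totalTopplings a
      N = + suc (n ℕ.+ d)
      M = + suc n

  mass : ∀ {n d} → Config n d → ℤ
  mass (uK , uI) = sum (lookup uK) + sum (lookup uI)

  val-sink : ∀ {n d} (u : Config n d) → val u sink ≡ - mass u
  val-sink (uK , uI) =
    cong₂ (λ x y → - (x + y)) (sumℤ-map-tabulate (lookup uK) (λ i → i)) (sumℤ-map-tabulate (lookup uI) (λ k → k))

  mass-act : ∀ {n d} (σK : Permutation′ n) (σI : Permutation′ d) (uK : Vec ℤ n) (uI : Vec ℤ d) →
             mass (act σK uK , act σI uI) ≡ mass (uK , uI)
  mass-act σK σI uK uI = cong₂ _+_ (sum-act σK uK) (sum-act σI uI)
    where
    sum-act : ∀ {m} (σ : Permutation′ m) (v : Vec ℤ m) → sum (lookup (act σ v)) ≡ sum (lookup v)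
    sum-act σ v = trans (sum-cong-≗ (lookup-permute σ (lookup v))) (sym (sum-permute (lookup v) σ))

  sink-balance : ∀ {n d} (c p : Config n d) (a : Vertex n d → ℤ) →
                 (∀ i → val c (vK i) ≡ val p (vK i) + toppleBy a (vK i)) →
                 (∀ k → val c (wI k) ≡ val p (wI k) + toppleBy a (wI k)) →
                 val c sink ≡ val p sink + toppleBy a sink
  sink-balance c@(cK , cI) p@(pK , pI) a at-vK at-wI = begin
    val c sink
      ≡⟨ val-sink c ⟩
    - (sum (lookup cK) + sum (lookup cI))
      ≡⟨ cong₂ (λ x y → - (x + y)) (sum-cong-≗ at-vK) (sum-cong-≗ at-wI) ⟩
    - (sum (λ i → lookup pK i + tK i) + sum (λ k → lookup pI k + tI k))
      ≡⟨ cong₂ (λ x y → - (x + y)) (∑-distrib-+ (lookup pK) tK) (∑-distrib-+ (lookup pI) tI) ⟩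
    - ((sum (lookup pK) + sum tK) + (sum (lookup pI) + sum tI))
      ≡⟨ solve 5 (λ P Q A B S → :- ((P :+ A) :+ (Q :+ B)) := (:- (P :+ Q) :+ S) :- (S :+ (A :+ B)))
               refl (sum (lookup pK)) (sum (lookup pI)) (sum tK) (sum tI) (toppleBy a sink) ⟩
    (- mass p + toppleBy a sink) - (toppleBy a sink + (sum tK + sum tI))
      ≡⟨ cong (λ x → (- mass p + toppleBy a sink) - x) (toppleBy-conserves a) ⟩
    (- mass p + toppleBy a sink) - 0ℤ
      ≡⟨ ℤP.+-identityʳ _ ⟩
    - mass p + toppleBy a sink
      ≡⟨ cong (_+ toppleBy a sink) (val-sink p) ⟨
    val p sink + toppleBy a sink ∎
    where
    open ≡-Reasoning
    tK = λ i → toppleBy a (vK i)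
    tI = λ k → toppleBy a (wI k)

  -- The n + 1 sorted quasi-stable non-negative representatives

  module Representatives {n d : ℕ} (uK : Vec ℤ n) (uI : Vec ℤ d) where

    -- The argument a of the definitions below is the number of firings of the sink and the clique
    -- together; topplings a is then the number of firings of all vertices.

    M N : ℕ
    M = suc n
    N = suc (n ℕ.+ d)

    independentTopplings : ℤ → Fin d → ℤ
    independentTopplings a k = (lookup uI k + a) /ℕ M

    independentValue : ℤ → Fin d → ℤ
    independentValue a k = + ((lookup uI k + a) %ℕ M)

    topplings : ℤ → ℤ
    topplings a = a + sum (independentTopplings a)

    cliqueTopplings : ℤ → Fin n → ℤ
    cliqueTopplings a i = (lookup uK i + topplings a) /ℕ N

    cliqueValue : ℤ → Fin n → ℤ
    cliqueValue a i = + ((lookup uK i + topplings a) %ℕ N)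

    σK : ℤ → Permutation′ n
    σK a = proj₁ (sortingPermutation (cliqueValue a))

    σI : ℤ → Permutation′ d
    σI a = proj₁ (sortingPermutation (independentValue a))

    representative : ℤ → Config n d
    representative a = permute (σK a) (cliqueValue a) , permute (σI a) (independentValue a)

    toppling : ℤ → Vertex n d → ℤ
    toppling a sink   = a - sum (λ i → cliqueTopplings a (σK a ⟨$⟩ʳ i))
    toppling a (vK i) = cliqueTopplings a (σK a ⟨$⟩ʳ i)
    toppling a (wI k) = independentTopplings a (σI a ⟨$⟩ʳ k)

    representative-sorted : ∀ a → Sorted (representative a)
    representative-sorted a = proj₂ (sortingPermutation (cliqueValue a)) , proj₂ (sortingPermutation (independentValue a))

    cliqueValue-≤ : ∀ a i → cliqueValue a i ≤ + (n ℕ.+ d)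
    cliqueValue-≤ a i = +≤+ (ℕ.s≤s⁻¹ (n%ℕd<d (lookup uK i + topplings a) N))

    independentValue-≤ : ∀ a k → independentValue a k ≤ + n
    independentValue-≤ a k = +≤+ (ℕ.s≤s⁻¹ (n%ℕd<d (lookup uI k + a) M))

    representative-quasiStable : ∀ a → QuasiStable (representative a)
    representative-quasiStable a =
      (λ i → subst (_≤ + (n ℕ.+ d)) (sym (lookup-permute (σK a) (cliqueValue a) i)) (cliqueValue-≤ a _)) ,
      (λ k → subst (_≤ + n) (sym (lookup-permute (σI a) (independentValue a) k)) (independentValue-≤ a _))

    representative-nonNegative : ∀ a → NonNegative (representative a)
    representative-nonNegative a =
      (λ i → subst (0ℤ ≤_) (sym (lookup-permute (σK a) (cliqueValue a) i)) (+≤+ z≤n)) ,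
      (λ k → subst (0ℤ ≤_) (sym (lookup-permute (σI a) (independentValue a) k)) (+≤+ z≤n))

    toppling-sink+clique : ∀ a → toppling a sink + sum (λ i → toppling a (vK i)) ≡ a
    toppling-sink+clique a = solve 2 (λ a S → (a :- S) :+ S := a) refl a (sum (λ i → toppling a (vK i)))

    totalTopplings-toppling : ∀ a → totalTopplings (toppling a) ≡ topplings a
    totalTopplings-toppling a = begin
      toppling a sink + (sum (λ i → toppling a (vK i)) + sum (λ k → toppling a (wI k)))
        ≡⟨ ℤP.+-assoc (toppling a sink) _ _ ⟨
      (toppling a sink + sum (λ i → toppling a (vK i))) + sum (λ k → toppling a (wI k))
        ≡⟨ cong₂ _+_ (toppling-sink+clique a) (sym (sum-permute (independentTopplings a) (σI a))) ⟩
      topplings a ∎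
      where open ≡-Reasoning

    representative-vK : ∀ a i → val (representative a) (vK i) ≡ lookup (act (σK a) uK) i + toppleBy (toppling a) (vK i)
    representative-vK a i = begin
      lookup (permute (σK a) (cliqueValue a)) i
        ≡⟨ lookup-permute (σK a) (cliqueValue a) i ⟩
      cliqueValue a π
        ≡⟨ +[a%ℕn]≡a-n*[a/ℕn] N (lookup uK π + topplings a) ⟩
      (lookup uK π + topplings a) - + N * cliqueTopplings a π
        ≡⟨ ℤP.+-assoc (lookup uK π) (topplings a) _ ⟩
      lookup uK π + (topplings a - + N * toppling a (vK i))
        ≡⟨ cong₂ (λ x y → x + (y - + N * toppling a (vK i)))
                 (lookup-permute (σK a) (lookup uK) i) (totalTopplings-toppling a) ⟨
      lookup (act (σK a) uK) i + (totalTopplings (toppling a) - + N * toppling a (vK i))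
        ≡⟨ cong (_+_ (lookup (act (σK a) uK) i)) (toppleBy-vK (toppling a) i) ⟨
      lookup (act (σK a) uK) i + toppleBy (toppling a) (vK i) ∎
      where
      open ≡-Reasoning
      π = σK a ⟨$⟩ʳ i

    representative-wI : ∀ a k → val (representative a) (wI k) ≡ lookup (act (σI a) uI) k + toppleBy (toppling a) (wI k)
    representative-wI a k = begin
      lookup (permute (σI a) (independentValue a)) k
        ≡⟨ lookup-permute (σI a) (independentValue a) k ⟩
      independentValue a π
        ≡⟨ +[a%ℕn]≡a-n*[a/ℕn] M (lookup uI π + a) ⟩
      (lookup uI π + a) - + M * independentTopplings a π
        ≡⟨ ℤP.+-assoc (lookup uI π) a _ ⟩
      lookup uI π + (a - + M * toppling a (wI k))
        ≡⟨ cong₂ (λ x y → x + (y - + M * toppling a (wI k)))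
                 (lookup-permute (σI a) (lookup uI) k) (toppling-sink+clique a) ⟨
      lookup (act (σI a) uI) k + ((toppling a sink + sum (λ i → toppling a (vK i))) - + M * toppling a (wI k))
        ≡⟨ cong (_+_ (lookup (act (σI a) uI) k)) (toppleBy-wI (toppling a) k) ⟨
      lookup (act (σI a) uI) k + toppleBy (toppling a) (wI k) ∎
      where
      open ≡-Reasoning
      π = σI a ⟨$⟩ʳ k

    representative-equivalent : ∀ a → TPEquiv (uK , uI) (representative a)
    representative-equivalent a = σK a , σI a , toppling a , λ where
      sink   → sink-balance (representative a) (act (σK a) uK , act (σI a) uI) (toppling a)
                            (representative-vK a) (representative-wI a)
      (vK i) → representative-vK a i
      (wI k) → representative-wI a k

    representative-sink : ∀ a → val (representative a) sink ≡ val (uK , uI) sink + (topplings a - + N * toppling a sink)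
    representative-sink a = begin
      val (representative a) sink
        ≡⟨ sink-balance (representative a) p (toppling a) (representative-vK a) (representative-wI a) ⟩
      val p sink + toppleBy (toppling a) sink
        ≡⟨ cong₂ _+_ (trans (val-sink p) (trans (cong -_ (mass-act (σK a) (σI a) uK uI)) (sym (val-sink (uK , uI)))))
                     (trans (toppleBy-sink (toppling a)) (cong (_- + N * toppling a sink) (totalTopplings-toppling a))) ⟩
      val (uK , uI) sink + (topplings a - + N * toppling a sink) ∎
      where
      open ≡-Reasoning
      p = (act (σK a) uK , act (σI a) uI)

    topplings-strictMono : ∀ {a b} → a < b → topplings a < topplings b
    topplings-strictMono a<b =
      ℤP.+-mono-<-≤ a<b (sum-mono-≤ (λ k → /ℕ-monoˡ-≤ M (ℤP.+-monoʳ-≤ (lookup uI k) (ℤP.<⇒≤ a<b))))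

    topplings-<-+N : ∀ {a b} → b ≤ a + + n → topplings b < topplings a + + N
    topplings-<-+N {a} {b} b≤a+n = begin-strict
      b + sum (independentTopplings b)
        ≤⟨ ℤP.+-mono-≤ b≤a+n (sum-mono-≤ (λ k → /ℕ-≤-/ℕ+1 M {lookup uI k + a} (Y+b<Y+a+M k))) ⟩
      (a + + n) + sum (λ k → independentTopplings a k + 1ℤ)
        ≡⟨ cong (_+_ (a + + n)) (trans (∑-distrib-+ (independentTopplings a) (λ _ → 1ℤ))
                                       (cong (_+_ S) (sum-const {d} 1ℤ))) ⟩
      (a + + n) + (S + + d * 1ℤ)
        ≡⟨ solve 4 (λ a S n d → (a :+ n) :+ (S :+ d :* con 1ℤ) := (a :+ S) :+ (n :+ d)) refl a S (+ n) (+ d) ⟩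
      topplings a + (+ n + + d)
        ≡⟨ cong (_+_ (topplings a)) (ℤP.pos-+ n d) ⟨
      topplings a + + (n ℕ.+ d)
        <⟨ ℤP.+-monoʳ-< (topplings a) (+<+ (ℕP.n<1+n _)) ⟩
      topplings a + + N ∎
      where
      open ℤP.≤-Reasoning
      S = sum (independentTopplings a)
      Y+b<Y+a+M : ∀ k → lookup uI k + b < (lookup uI k + a) + + M
      Y+b<Y+a+M k = begin-strict
        lookup uI k + b           ≤⟨ ℤP.+-monoʳ-≤ (lookup uI k) b≤a+n ⟩
        lookup uI k + (a + + n)   <⟨ ℤP.+-monoʳ-< (lookup uI k) (ℤP.+-monoʳ-< a (+<+ (ℕP.n<1+n n))) ⟩
        lookup uI k + (a + + M)   ≡⟨ ℤP.+-assoc (lookup uI k) a (+ M) ⟨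
        (lookup uI k + a) + + M   ∎

    representatives-distinct : ∀ {a b} → a < b → b ≤ a + + n → representative a ≢ representative b
    representatives-distinct {a} {b} a<b b≤a+n rep≡ = ¬0<n*q<n N q
      (+-cancelˡ-< (topplings a) (subst₂ _<_ (sym (ℤP.+-identityʳ (topplings a))) tb≡ (topplings-strictMono a<b)))
      (+-cancelˡ-< (topplings a) (subst (_< topplings a + + N) tb≡ (topplings-<-+N {a} b≤a+n)))
      where
      open ≡-Reasoning
      x = val (uK , uI) sink
      sa = toppling a sink
      sb = toppling b sink
      q = sb - sa
      same-sink : x + (topplings b - + N * sb) ≡ x + (topplings a - + N * sa)
      same-sink = trans (sym (representative-sink b)) (trans (cong (λ c → val c sink) (sym rep≡)) (representative-sink a))
      tb≡ : topplings b ≡ topplings a + + N * q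
      tb≡ = begin
        topplings b
          ≡⟨ solve 4 (λ x t N s → t := ((x :+ (t :- N :* s)) :- x) :+ N :* s) refl x (topplings b) (+ N) sb ⟩
        ((x + (topplings b - + N * sb)) - x) + + N * sb
          ≡⟨ cong (λ y → (y - x) + + N * sb) same-sink ⟩
        ((x + (topplings a - + N * sa)) - x) + + N * sb
          ≡⟨ solve 5 (λ x t N s r → ((x :+ (t :- N :* s)) :- x) :+ N :* r := t :+ N :* (r :- s))
                   refl x (topplings a) (+ N) sa sb ⟩
        topplings a + + N * q ∎

    independentTopplings-+M* : ∀ a q k → independentTopplings (a + + M * q) k ≡ independentTopplings a k + q
    independentTopplings-+M* a q k =
      trans (cong (_/ℕ M) (sym (ℤP.+-assoc (lookup uI k) a _))) ([a+n*q]/ℕn≡a/ℕn+q M (lookup uI k + a) q)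

    independentValue-+M* : ∀ a q k → independentValue (a + + M * q) k ≡ independentValue a k
    independentValue-+M* a q k =
      cong +_ (trans (cong (_%ℕ M) (sym (ℤP.+-assoc (lookup uI k) a _))) ([a+n*q]%ℕn≡a%ℕn M (lookup uI k + a) q))

    topplings-+M* : ∀ a q → topplings (a + + M * q) ≡ topplings a + + N * q
    topplings-+M* a q = begin
      (a + + M * q) + sum (independentTopplings (a + + M * q))
        ≡⟨ cong (_+_ (a + + M * q)) (trans (sum-cong-≗ (independentTopplings-+M* a q))
                                            (trans (∑-distrib-+ (independentTopplings a) (λ _ → q)) (cong (_+_ S) (sum-const {d} q)))) ⟩
      (a + + M * q) + (S + + d * q)
        ≡⟨ solve 5 (λ a q S n d → (a :+ (con 1ℤ :+ n) :* q) :+ (S :+ d :* q) := (a :+ S) :+ (con 1ℤ :+ (n :+ d)) :* q)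
                 refl a q S (+ n) (+ d) ⟩
      topplings a + (1ℤ + (+ n + + d)) * q
        ≡⟨ cong (λ z → topplings a + (1ℤ + z) * q) (ℤP.pos-+ n d) ⟨
      topplings a + + N * q ∎
      where
      open ≡-Reasoning
      S = sum (independentTopplings a)

    cliqueValue-+M* : ∀ a q i → cliqueValue (a + + M * q) i ≡ cliqueValue a i
    cliqueValue-+M* a q i = cong +_ (begin
      (lookup uK i + topplings (a + + M * q)) %ℕ N   ≡⟨ cong (λ t → (lookup uK i + t) %ℕ N) (topplings-+M* a q) ⟩
      (lookup uK i + (topplings a + + N * q)) %ℕ N   ≡⟨ cong (_%ℕ N) (ℤP.+-assoc (lookup uK i) (topplings a) _) ⟨
      ((lookup uK i + topplings a) + + N * q) %ℕ N   ≡⟨ [a+n*q]%ℕn≡a%ℕn N (lookup uK i + topplings a) q ⟩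
      (lookup uK i + topplings a) %ℕ N ∎)
      where open ≡-Reasoning

    a≡a%M+M*[a/M] : ∀ a → a ≡ + (a %ℕ M) + + M * (a /ℕ M)
    a≡a%M+M*[a/M] a = trans (a≡a%ℕn+[a/ℕn]*n a M) (cong (_+_ (+ (a %ℕ M))) (ℤP.*-comm (a /ℕ M) (+ M)))

    cliqueValue-mod : ∀ a i → cliqueValue a i ≡ cliqueValue (+ (a %ℕ M)) i
    cliqueValue-mod a i =
      trans (cong (λ b → cliqueValue b i) (a≡a%M+M*[a/M] a)) (cliqueValue-+M* (+ (a %ℕ M)) (a /ℕ M) i)

    independentValue-mod : ∀ a k → independentValue a k ≡ independentValue (+ (a %ℕ M)) k
    independentValue-mod a k =
      trans (cong (λ b → independentValue b k) (a≡a%M+M*[a/M] a)) (independentValue-+M* (+ (a %ℕ M)) (a /ℕ M) k)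

    level : (Vertex n d → ℤ) → ℤ
    level t = t sink + sum (λ i → t (vK i))

    values-forced : ∀ {cK cI} (τK : Permutation′ n) (τI : Permutation′ d) (t : Vertex n d → ℤ) →
                    QuasiStable (cK , cI) → NonNegative (cK , cI) →
                    (∀ x → val (cK , cI) x ≡ val (act τK uK , act τI uI) x + toppleBy t x) →
                    (∀ i → lookup cK i ≡ cliqueValue (level t) (τK ⟨$⟩ʳ i)) ×
                    (∀ k → lookup cI k ≡ independentValue (level t) (τI ⟨$⟩ʳ k))
    values-forced {cK} {cI} τK τI t (cK≤ , cI≤) (cK≥0 , cI≥0) eq = clique , (λ k → sym (proj₂ (independent k)))
      where
      open ≡-Reasoning
      T = level t
      independent : ∀ k → independentTopplings T (τI ⟨$⟩ʳ k) ≡ t (wI k) × independentValue T (τI ⟨$⟩ʳ k) ≡ lookup cI k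
      independent k = /ℕ-%ℕ-unique M (Y + T) (cI≥0 k) (ℤP.≤-<-trans (cI≤ k) (+<+ (ℕP.n<1+n n))) (begin
        lookup cI k                                ≡⟨ eq (wI k) ⟩
        lookup (act τI uI) k + toppleBy t (wI k)   ≡⟨ cong₂ _+_ (lookup-permute τI (lookup uI) k) (toppleBy-wI t k) ⟩
        Y + (T - + M * t (wI k))                   ≡⟨ ℤP.+-assoc Y T _ ⟨
        (Y + T) - + M * t (wI k)                   ∎)
        where Y = lookup uI (τI ⟨$⟩ʳ k)

      totalTopplings-t : totalTopplings t ≡ topplings T
      totalTopplings-t = begin
        t sink + (sum (λ i → t (vK i)) + sum (λ k → t (wI k)))
          ≡⟨ ℤP.+-assoc (t sink) _ _ ⟨
        T + sum (λ k → t (wI k))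
          ≡⟨ cong (_+_ T) (sum-cong-≗ (λ k → proj₁ (independent k))) ⟨
        T + sum (λ k → independentTopplings T (τI ⟨$⟩ʳ k))
          ≡⟨ cong (_+_ T) (sum-permute (independentTopplings T) τI) ⟨
        topplings T ∎

      clique : ∀ i → lookup cK i ≡ cliqueValue T (τK ⟨$⟩ʳ i)
      clique i = sym (proj₂ (/ℕ-%ℕ-unique N (X + topplings T) (cK≥0 i) (ℤP.≤-<-trans (cK≤ i) (+<+ (ℕP.n<1+n _))) (begin
        lookup cK i                                ≡⟨ eq (vK i) ⟩
        lookup (act τK uK) i + toppleBy t (vK i)   ≡⟨ cong₂ _+_ (lookup-permute τK (lookup uK) i) (toppleBy-vK t i) ⟩
        X + (totalTopplings t - + N * t (vK i))    ≡⟨ cong (λ z → X + (z - + N * t (vK i))) totalTopplings-t ⟩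
        X + (topplings T - + N * t (vK i))         ≡⟨ ℤP.+-assoc X (topplings T) _ ⟨
        (X + topplings T) - + N * t (vK i)         ∎)))
        where X = lookup uK (τK ⟨$⟩ʳ i)

    representative-complete : ∀ c → Sorted c → QuasiStable c → NonNegative c → TPEquiv (uK , uI) c →
                              ∃ λ (r : Fin M) → c ≡ representative (+ toℕ r)
    representative-complete (cK , cI) (cK↓ , cI↓) c≤ c≥0 (τK , τI , t , eq) =
      r , subst (λ a → (cK , cI) ≡ representative a) (cong +_ (sym (FinP.toℕ-fromℕ< (n%ℕd<d T M)))) (cong₂ _,_
        (decreasing-rearrangement≡sorted (cliqueValue a₀) τK cK↓ λ i →
          trans (proj₁ forced i) (cliqueValue-mod T (τK ⟨$⟩ʳ i)))
        (decreasing-rearrangement≡sorted (independentValue a₀) τI cI↓ λ k →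
          trans (proj₂ forced k) (independentValue-mod T (τI ⟨$⟩ʳ k))))
      where
      T = level t
      a₀ = + (T %ℕ M)
      r = fromℕ< (n%ℕd<d T M)
      forced = values-forced τK τI t c≤ c≥0 eq

    within-period : ∀ (r s : Fin M) → + toℕ s ≤ + toℕ r + + n
    within-period r s =
      subst (+ toℕ s ≤_) (ℤP.pos-+ (toℕ r) n) (+≤+ (ℕP.≤-trans (ℕ.s≤s⁻¹ (FinP.toℕ<n s)) (ℕP.m≤n+m n (toℕ r))))

    representative-injective : ∀ {r s : Fin M} → representative (+ toℕ r) ≡ representative (+ toℕ s) → r ≡ s
    representative-injective {r} {s} rep≡ with ℕP.<-cmp (toℕ r) (toℕ s)
    ... | tri< r<s _ _ = ⊥-elim (representatives-distinct (+<+ r<s) (within-period r s) rep≡)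
    ... | tri≈ _ r≡s _ = FinP.toℕ-injective r≡s
    ... | tri> _ _ s<r = ⊥-elim (representatives-distinct (+<+ s<r) (within-period s r) (sym rep≡))

open Lemmas
open import Data.Nat using (ℕ; _≤_; _+_)
open import Data.List using (List; length)
open import Data.List.Relation.Unary.Unique.Propositional using (Unique)
open import Data.List.Membership.Propositional using (_∈_)
open import Data.Product using (Σ; _×_)
open import Relation.Binary.PropositionalEquality using (_≡_)
open import Function.Bundles using (_⇔_)
open import Data.Nat using (suc)
open import Data.Nat.Properties using (+-comm)
open import Data.Integer using (+_)
open import Data.Fin using (Fin; toℕ)
open import Data.List using (map; allFin)
open import Data.List.Properties using (length-map; length-tabulate)
open import Data.List.Relation.Unary.Unique.Propositional.Properties using (map⁺; allFin⁺)
open import Data.List.Membership.Propositional.Properties using (∈-map⁺; ∈-map⁻; ∈-allFin)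
open import Data.Product using (_,_)
open import Relation.Binary.PropositionalEquality using (trans; sym; subst)
open import Function.Bundles using (mk⇔)
open import Function.Base using (case_of_)

proposition5p8 : (n d : ℕ) → 1 ≤ n → (u : Config n d) → Sorted u → Compact u →
    Σ (List (Config n d)) λ L → length L ≡ n + 1 × Unique L ×
      ((c : Config n d) →
        (c ∈ L) ⇔ (Sorted c × QuasiStable c × NonNegative c × TPEquiv u c))
proposition5p8 n d _ (uK , uI) _ _ =
  L , length-L , map⁺ representative-injective (allFin⁺ (suc n)) , λ c → mk⇔ (sound c) (complete c)
  where
  open Representatives uK uI
  Valid : Config n d → Set
  Valid c = Sorted c × QuasiStable c × NonNegative c × TPEquiv (uK , uI) c
  representativeᶠ : Fin (suc n) → Config n d
  representativeᶠ r = representative (+ toℕ r)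
  L : List (Config n d)
  L = map representativeᶠ (allFin (suc n))
  length-L : length L ≡ n + 1
  length-L = trans (length-map representativeᶠ (allFin (suc n))) (trans (length-tabulate (λ r → r)) (+-comm 1 n))
  valid : ∀ r → Valid (representativeᶠ r)
  valid r = representative-sorted a , representative-quasiStable a , representative-nonNegative a , representative-equivalent a
    where a = + toℕ r
  sound : ∀ c → c ∈ L → Valid c
  sound c c∈L = case ∈-map⁻ representativeᶠ c∈L of λ where
    (r , _ , c≡) → subst Valid (sym c≡) (valid r)
  complete : ∀ c → Valid c → c ∈ L
  complete c (c↓ , c≤ , c≥0 , c≈u) = case representative-complete c c↓ c≤ c≥0 c≈u of λ where
    (r , c≡) → subst (_∈ L) (sym c≡) (∈-map⁺ representativeᶠ (∈-allFin r))
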